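{- Let $V=\mathbb{F}_q^n$ with a fixed total order $\omega$ on its lines, and consider the lexicographic discrete Morse function on $\Delta(PD(1^n,q))$ coming from the labelling of each covering relation by the line being added. For every saturated chain $N$ of $PD(1^n,q)$, the minimal skipped intervals of $N$ are exactly (1) the single ranks at which $N$ has a descent of its label sequence, and (2) the top intervals of $N$.
   Context: $PD(1^n,q)$: elements are sets of linearly independent lines of $V$ (minimum $\hat0=\emptyset$), ordered by inclusion, with a maximum $\hat1$ adjoined above the bases. A covering $\{l_1,\dots,l_r\}\prec\{l_1,\dots,l_{r+1}\}$ is labelled $l_{r+1}$; labels are compared by $\omega$; covering relations into $\hat1$ are unlabelled, so the label sequence of a saturated chain is the ordered list of the lines of a basis $B$ (its label set). Saturated chains are ordered $F_1,F_2,\dots$ lexicographically by label sequence; for each $j$, every maximal face of $F_j\cap\bigcup_{i<j}F_i$ (as faces of the order complex, i.e. subchains of the interior $\hat0<\cdots<\hat1$) omits the elements of $F_j$ in exactly one interval of consecutive ranks, and these rank intervals are the minimal skipped intervals of $F_j$. A descent at rank $r$ means the label of the edge into rank $r$ is larger than that of the edge out of rank $r$. An element $l$ of a basis $B$ is internally active in $B$ if there is no line $l'$ smaller than $l$ in $\omega$ such that $(B\setminus\{l\})\cup\{l'\}$ is a basis. For a saturated chain $N=\hat0\prec x_1\prec\cdots\prec x_k\prec x\prec y_1\prec\cdots\prec y_l\prec\hat1$ with label set $B$ and strictly increasing labels from $x$ up to $y_l$, the interval $(x,\hat1)$ (i.e. the rank interval occupied by $y_1,\dots,y_l$) is a top interval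 of $N$ if the label of $x\prec y_1$ is not internally active in $B$ and the label of each $y_i\prec y_{i+1}$ is internally active in $B$. -}

module Defs where

open import Level using (Level; _⊔_) renaming (suc to lsuc)
open import Data.Nat using (ℕ; suc)
open import Data.Fin using (Fin; toℕ; _≤_; _<_; _≟_)
open import Data.List using (List)
open import Data.List.Relation.Unary.Any using (Any)
open import Data.Product using (Σ; ∃; _×_)
open import Relation.Nullary using (¬_; yes; no)
open import Relation.Binary.PropositionalEquality using (_≡_)
open import Relation.Binary.Definitions using (Decidable)
open import Relation.Unary using (Pred; _∈_; _∉_; _⊆_)
open import Function using (_∘_; _⇔_)
open import Algebra.Bundles using (CommutativeRing)
import Algebra.Properties.Monoid.Sum as MonoidSum

record FiniteField (c ℓ : Level) : Set (lsuc (c ⊔ ℓ)) where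
  field
    commutativeRing : CommutativeRing c ℓ
  open CommutativeRing commutativeRing public
  field
    _≈?_     : Decidable _≈_
    1≉0      : ¬ (1# ≈ 0#)
    inverse  : ∀ x → ¬ (x ≈ 0#) → ∃ λ y → (x * y) ≈ 1#
    elements : List Carrier
    complete : ∀ x → Any (x ≈_) elements

module Space {c ℓ : Level} (F : FiniteField c ℓ) (n : ℕ) where
  open FiniteField F
  open MonoidSum +-monoid using (sum)

  V : Set c
  V = Fin n → Carrier

  IsZero : V → Set ℓ
  IsZero v = ∀ i → v i ≈ 0#

  Independent : ∀ {k} → (Fin k → V) → Set (c ⊔ ℓ)
  Independent {k} v =
    (coef : Fin k → Carrier) →
    (∀ i → sum (λ a → coef a * v a i) ≈ 0#) →
    ∀ a → coef a ≈ 0#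

-- A total order ω on the lines of V, given as an enumeration
-- rep : Fin m → V choosing one representative for each line, each line
-- occurring exactly once; ω is the order of the indices.

record LineOrdering {c ℓ : Level} (F : FiniteField c ℓ) (n : ℕ) : Set (c ⊔ ℓ) where
  open FiniteField F
  open Space F n
  field
    m           : ℕ
    rep         : Fin m → V
    rep-nonzero : ∀ l → ¬ IsZero (rep l)
    rep-covers  : ∀ v → ¬ IsZero v → ∃ λ l → ∃ λ s → ∀ i → v i ≈ (s * rep l i)
    rep-unique  : ∀ l l' s → (∀ i → rep l i ≈ (s * rep l' i)) → l ≡ l'

-- A saturated chain  0̂ ≺ x₁ ≺ ⋯ ≺ xₙ ≺ 1̂  is determined by its label
-- sequence label : Fin n → Line (xᵣ = {label 0,…,label (r-1)}), which
-- must be an ordered basis.  Position p : Fin n stands for rank toℕ p + 1;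
-- label p is the label of the covering x_{toℕ p} ≺ x_{toℕ p + 1}.

module PD {c ℓ : Level} (F : FiniteField c ℓ) (n : ℕ) (L : LineOrdering F n) where
  open FiniteField F
  open Space F n
  open LineOrdering L

  Line : Set
  Line = Fin m

  IsBasis : (Fin n → Line) → Set (c ⊔ ℓ)
  IsBasis f = Independent (rep ∘ f)

  record SaturatedChain : Set (c ⊔ ℓ) where
    field
      label : Fin n → Line
      basis : IsBasis label
  open SaturatedChain public

  _<lex_ : SaturatedChain → SaturatedChain → Set
  M <lex N = ∃ λ p → (∀ a → a < p → label M a ≡ label N a) × label M p < label N p

  SameElementAt : SaturatedChain → SaturatedChain → Fin n → Set
  SameElementAt M N p =
    ∀ t → (∃ λ a → a ≤ p × label M a ≡ t) ⇔ (∃ λ b → b ≤ p × label N b ≡ t)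

  -- faces of the simplex F_N (of the order complex of the interior), given
  -- by the set of positions (ranks) of the chosen elements
  Face : Set₁
  Face = Pred (Fin n) Level.zero

  -- S is a face of  F_N ∩ ⋃_{M <lex N} F_M
  InEarlier : SaturatedChain → Face → Set (c ⊔ ℓ)
  InEarlier N S = ∃ λ M → M <lex N × (∀ p → p ∈ S → SameElementAt M N p)

  MaximalFace : SaturatedChain → Face → Set (lsuc Level.zero ⊔ c ⊔ ℓ)
  MaximalFace N S =
    InEarlier N S ×
    (∀ (S' : Face) → S ⊆ S' → (∃ λ p → p ∈ S' × p ∉ S) → ¬ InEarlier N S')

  OutsideInterval : Fin n → Fin n → Face
  OutsideInterval a b p = ¬ (a ≤ p × p ≤ b)

  MinimalSkippedInterval : SaturatedChain → Fin n → Fin n → Set (lsuc Level.zero ⊔ c ⊔ ℓ)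
  MinimalSkippedInterval N a b = a ≤ b × MaximalFace N (OutsideInterval a b)

  Descent : SaturatedChain → Fin n → Set
  Descent N a = ∃ λ b → toℕ b ≡ suc (toℕ a) × label N b < label N a

  replace : (Fin n → Line) → Fin n → Line → (Fin n → Line)
  replace f p l q with q ≟ p
  ... | yes _ = l
  ... | no  _ = f q

  InternallyActive : SaturatedChain → Fin n → Set (c ⊔ ℓ)
  InternallyActive N p =
    ¬ (∃ λ l' → l' < label N p × IsBasis (replace (label N) p l'))

  -- positions a..b form a top interval: x has rank toℕ a (x = 0̂ allowed),
  -- y_l is the top element (b last), labels strictly increasing from
  -- position a on, label at a not internally active, later ones active
  TopInterval : SaturatedChain → Fin n → Fin n → Set (c ⊔ ℓ)
  TopInterval N a b =
    suc (toℕ b) ≡ n ×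
    (∀ p q → a ≤ p → p < q → label N p < label N q) ×
    ¬ InternallyActive N a ×
    (∀ p → a < p → InternallyActive N p)

module Submission where

open import Defs
open import Level using (Level; _⊔_; 0ℓ) renaming (suc to lsuc)
open import Data.Nat as ℕ using (ℕ; zero; suc; z≤n; s≤s)
import Data.Nat.Properties as ℕP
open import Data.Fin as Fin using (Fin; zero; suc; toℕ; punchIn; _≤_; _<_)
import Data.Fin.Properties as FinP
open import Data.Fin.Properties using (punchInᵢ≢i)
open import Data.Fin.Permutation as Perm using (Permutation; _⟨$⟩ʳ_; _⟨$⟩ˡ_)
import Data.Fin.Permutation.Components as PC
open import Data.Vec.Functional using (updateAt; insertAt; removeAt; _∷_)
open import Data.Vec.Functional.Properties
  using (updateAt-updates; updateAt-minimal; insertAt-lookup; insertAt-punchIn)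
open import Data.List as List using (List; cartesianProductWith)
open import Data.List.Relation.Unary.Any as Any using (Any; here)
open import Data.List.Relation.Unary.Any.Properties using (cartesianProductWith⁺)
open import Data.Product using (∃; _×_; _,_; proj₁; proj₂)
open import Data.Sum using (_⊎_; inj₁; inj₂; [_,_])
open import Data.Empty using (⊥; ⊥-elim)
open import Relation.Nullary using (¬_; Dec; yes; no)
open import Relation.Nullary.Decidable using (decidable-stable; ¬?; _×-dec_)
open import Relation.Binary.Definitions using (tri<; tri≈; tri>)
open import Relation.Binary.PropositionalEquality as ≡ using (_≡_; _≢_; refl; cong; cong₂; subst)
open import Relation.Unary using (_⊆_; _∈_; _∉_)
open import Function using (_∘_; _$_; const; _⇔_; mk⇔; Equivalence)

-- An earlier chain M <lex N that shares the elements of N outside the ranks [a,b] first differs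
-- from N at some rank d in [a,b], and the line label M d occurs later in N or not at all.  If it
-- occurs later, N has a descent in between; swapping the two labels of a descent gives an earlier
-- chain that differs from N at that single rank, so by minimality [a,b] is that rank.  If it does
-- not occur, every element of N from rank d upward is lost, so [a,b] reaches the top.  Barring a
-- descent the labels increase from a on, and exchanging label M d into the basis of N (Steinitz)
-- at some position j ≥ d makes label N j internally passive, as label M d < label N d ≤ label N j.
-- Replacing an internally passive label by the smaller line gives an earlier chain that agrees
-- with N below it, so by minimality only the label at a is passive: [a,b] is a top interval.
-- The same two constructions show conversely that descents and top intervals are minimal.

module LinearAlgebra {c ℓ : Level} (F : FiniteField c ℓ) where
  open FiniteField F hiding (zero)
  open Space F using (Independent)
  open import Algebra.Properties.Semiring.Sum semiring
    using ( sum; sum-cong-≋; sum-cong-≗; sum-replicate-zero; sum-remove; ∑-distrib-+; sum-permute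
          ; *-distribˡ-sum; *-distribʳ-sum)
  open import Algebra.Properties.Ring ring
    using (-‿distribˡ-*; -‿distribʳ-*; -1*x≈-x; -‿involutive; -0#≈0#; +-inverseʳ-unique)
  open import Algebra.Properties.CommutativeSemigroup *-commutativeSemigroup using (x∙yz≈y∙xz)
  open import Data.Vec.Functional.Relation.Binary.Equality.Setoid setoid using (_≋_)
  open import Relation.Binary.Reasoning.Setoid setoid

  *-cancelˡ-≈0 : ∀ {a b} → ¬ a ≈ 0# → a * b ≈ 0# → b ≈ 0#
  *-cancelˡ-≈0 {a} {b} a≉0 ab≈0 = begin
    b               ≈⟨ *-identityˡ b ⟨
    1# * b          ≈⟨ *-congʳ (trans (*-comm a⁻¹ a) a*a⁻¹≈1) ⟨
    a⁻¹ * a * b     ≈⟨ *-assoc a⁻¹ a b ⟩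
    a⁻¹ * (a * b)   ≈⟨ *-congˡ ab≈0 ⟩
    a⁻¹ * 0#        ≈⟨ zeroʳ a⁻¹ ⟩
    0#              ∎
    where
    a⁻¹ = proj₁ (inverse a a≉0)
    a*a⁻¹≈1 = proj₂ (inverse a a≉0)

  -x≈0⇒x≈0 : ∀ {x} → - x ≈ 0# → x ≈ 0#
  -x≈0⇒x≈0 {x} -x≈0 = trans (sym (-‿involutive x)) (trans (-‿cong -x≈0) -0#≈0#)

  -x*-yz≈y*xz : ∀ x y z → - x * - (y * z) ≈ y * (x * z)
  -x*-yz≈y*xz x y z = begin
    - x * - (y * z)     ≈⟨ -‿distribˡ-* x _ ⟨
    - (x * - (y * z))   ≈⟨ -‿cong (-‿distribʳ-* x _) ⟨
    - - (x * (y * z))   ≈⟨ -‿involutive _ ⟩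
    x * (y * z)         ≈⟨ x∙yz≈y∙xz x y z ⟩
    y * (x * z)         ∎

  sum-zero : ∀ {k} (f : Fin k → Carrier) → (∀ x → f x ≈ 0#) → sum f ≈ 0#
  sum-zero {k} f f≈0 = trans (sum-cong-≋ f≈0) (sum-replicate-zero k)

  sum-neg : ∀ {k} (f : Fin k → Carrier) → sum (λ x → - f x) ≈ - sum f
  sum-neg f = begin
    sum (λ x → - f x)       ≈⟨ sum-cong-≋ (λ x → sym (-1*x≈-x (f x))) ⟩
    sum (λ x → - 1# * f x)  ≈⟨ *-distribˡ-sum (- 1#) f ⟨
    - 1# * sum f            ≈⟨ -1*x≈-x (sum f) ⟩
    - sum f                 ∎

  δ : ∀ {k} → Fin k → Fin k → Carrier
  δ a = updateAt (const 0#) a (const 1#)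

  sum-δ : ∀ {k} (a : Fin k) (f : Fin k → Carrier) → sum (λ x → δ a x * f x) ≈ f a
  sum-δ {suc k} a f = begin
    sum (λ x → δ a x * f x)
      ≈⟨ sum-remove {i = a} (λ x → δ a x * f x) ⟩
    δ a a * f a + sum (λ b → δ a (punchIn a b) * f (punchIn a b))
      ≈⟨ +-cong (*-congʳ (reflexive (updateAt-updates a _))) (sum-zero _ off-a) ⟩
    1# * f a + 0#
      ≈⟨ trans (+-identityʳ _) (*-identityˡ (f a)) ⟩
    f a ∎
    where
    off-a : ∀ b → δ a (punchIn a b) * f (punchIn a b) ≈ 0#
    off-a b = trans (*-congʳ (reflexive (updateAt-minimal _ a _ (punchInᵢ≢i a b)))) (zeroˡ _)

  combination : ∀ {k n} → (Fin k → Carrier) → (Fin k → Fin n → Carrier) → Fin n → Carrier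
  combination g v i = sum (λ a → g a * v a i)

  combination-+ : ∀ {k n} (f g : Fin k → Carrier) (v : Fin k → Fin n → Carrier) i →
                  combination (λ a → f a + g a) v i ≈ combination f v i + combination g v i
  combination-+ f g v i =
    trans (sum-cong-≋ (λ a → distribʳ (v a i) (f a) (g a)))
          (∑-distrib-+ (λ a → f a * v a i) (λ a → g a * v a i))

  combination-* : ∀ {k n} s (f : Fin k → Carrier) (v : Fin k → Fin n → Carrier) i →
                  combination (λ a → s * f a) v i ≈ s * combination f v i
  combination-* s f v i =
    trans (sum-cong-≋ (λ a → *-assoc s (f a) (v a i))) (sym (*-distribˡ-sum s (λ a → f a * v a i)))

  combination-δ : ∀ {k n} (a : Fin k) (v : Fin k → Fin n → Carrier) i → combination (δ a) v i ≈ v a i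
  combination-δ a v i = sum-δ a (λ x → v x i)

  combination-updateAt : ∀ {k n} (e : Fin k → Carrier) (v : Fin k → Fin n → Carrier) j u i →
    combination e (updateAt v j (const u)) i ≈ combination (updateAt e j (const 0#)) v i + e j * u i
  combination-updateAt e v j u i = begin
    combination e (updateAt v j (const u)) i              ≈⟨ sum-cong-≋ split ⟩
    sum (λ x → E x * v x i + δ j x * (e j * u i))         ≈⟨ ∑-distrib-+ (λ x → E x * v x i) _ ⟩
    combination E v i + sum (λ x → δ j x * (e j * u i))   ≈⟨ +-congˡ (sum-δ j (const (e j * u i))) ⟩
    combination E v i + e j * u i                         ∎
    where
    E = updateAt e j (const 0#)
    split : ∀ x → e x * updateAt v j (const u) x i ≈ E x * v x i + δ j x * (e j * u i)
    split x with x Fin.≟ j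
    ... | yes refl rewrite updateAt-updates x {const u} v | updateAt-updates x {const 0#} e
                         | updateAt-updates x {const 1#} (const 0#) =
      sym (trans (+-cong (zeroˡ (v x i)) (*-identityˡ _)) (+-identityˡ _))
    ... | no  x≢j  rewrite updateAt-minimal x j {const u} v x≢j | updateAt-minimal x j {const 0#} e x≢j
                         | updateAt-minimal x j {const 1#} (const 0#) x≢j =
      sym (trans (+-congˡ (zeroˡ _)) (+-identityʳ _))

  independent-cong : ∀ {k n} {v w : Fin k → Fin n → Carrier} →
                     (∀ a i → v a i ≈ w a i) → Independent n v → Independent n w
  independent-cong v≈w ind g rel = ind g (λ i → trans (sum-cong-≋ (λ a → *-congˡ (v≈w a i))) (rel i))

  independent-permute : ∀ {k n} {v : Fin k → Fin n → Carrier} (π : Permutation k k) →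
                        Independent n v → Independent n (v ∘ (π ⟨$⟩ʳ_))
  independent-permute {v = v} π ind g rel x = begin
    g x              ≡⟨ cong g (Perm.inverseˡ π) ⟨
    g' (π ⟨$⟩ʳ x)     ≈⟨ ind g' rel' (π ⟨$⟩ʳ x) ⟩
    0#               ∎
    where
    g' = g ∘ (π ⟨$⟩ˡ_)
    rel' : ∀ i → combination g' v i ≈ 0#
    rel' i = begin
      combination g' v i
        ≈⟨ sum-permute (λ a → g' a * v a i) π ⟩
      sum (λ y → g' (π ⟨$⟩ʳ y) * v (π ⟨$⟩ʳ y) i)
        ≡⟨ sum-cong-≗ (λ y → cong (λ z → g z * v (π ⟨$⟩ʳ y) i) (Perm.inverseˡ π)) ⟩
      combination g (v ∘ (π ⟨$⟩ʳ_)) i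
        ≈⟨ rel i ⟩
      0# ∎

  independent-injective : ∀ {k n} {v : Fin k → Fin n → Carrier} {a b} →
                          Independent n v → (∀ i → v a i ≈ v b i) → a ≡ b
  independent-injective {v = v} {a} {b} ind va≈vb = decidable-stable (a Fin.≟ b) λ a≢b → 1≉0 (begin
    1#                     ≈⟨ trans (+-congˡ (zeroʳ (- 1#))) (+-identityʳ 1#) ⟨
    1# + - 1# * 0#
      ≡⟨ cong₂ (λ x y → x + - 1# * y) (updateAt-updates a _) (updateAt-minimal a b _ a≢b) ⟨
    δ a a + - 1# * δ b a   ≈⟨ ind g rel a ⟩
    0#                     ∎)
    where
    g = λ x → δ a x + - 1# * δ b x
    rel : ∀ i → combination g v i ≈ 0#
    rel i = begin
      combination g v i
        ≈⟨ combination-+ (δ a) _ v i ⟩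
      combination (δ a) v i + combination (λ x → - 1# * δ b x) v i
        ≈⟨ +-cong (combination-δ a v i) (combination-* (- 1#) (δ b) v i) ⟩
      v a i + - 1# * combination (δ b) v i
        ≈⟨ +-cong (va≈vb i) (trans (-1*x≈-x _) (-‿cong (combination-δ b v i))) ⟩
      v b i + - v b i
        ≈⟨ -‿inverseʳ (v b i) ⟩
      0# ∎

  eliminate : ∀ {k n} → (Fin (suc k) → Fin (suc n) → Carrier) → Fin (suc k) → Fin k → Fin n → Carrier
  eliminate v a b i = v a zero * v (punchIn a b) (suc i) - v (punchIn a b) zero * v a (suc i)

  combination-eliminate : ∀ {k n} (v : Fin (suc k) → Fin (suc n) → Carrier) a (e : Fin k → Carrier) i →
    combination e (eliminate v a) i ≈
    v a zero * combination e (removeAt v a) (suc i) + - (combination e (removeAt v a) zero * v a (suc i))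
  combination-eliminate v a e i = begin
    sum (λ b → e b * (p * A b + - (B b * z)))
      ≈⟨ sum-cong-≋ (λ b → expand (e b) (A b) (B b)) ⟩
    sum (λ b → p * (e b * A b) + - (e b * B b * z))
      ≈⟨ ∑-distrib-+ (λ b → p * (e b * A b)) (λ b → - (e b * B b * z)) ⟩
    sum (λ b → p * (e b * A b)) + sum (λ b → - (e b * B b * z))
      ≈⟨ +-cong (sym (*-distribˡ-sum p (λ b → e b * A b))) (sum-neg (λ b → e b * B b * z)) ⟩
    p * sum (λ b → e b * A b) + - sum (λ b → e b * B b * z)
      ≈⟨ +-congˡ (-‿cong (sym (*-distribʳ-sum z (λ b → e b * B b)))) ⟩
    p * sum (λ b → e b * A b) + - (sum (λ b → e b * B b) * z) ∎
    where
    p = v a zero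
    z = v a (suc i)
    A = λ b → v (punchIn a b) (suc i)
    B = λ b → v (punchIn a b) zero
    expand : ∀ x y w → x * (p * y + - (w * z)) ≈ p * (x * y) + - (x * w * z)
    expand x y w = begin
      x * (p * y + - (w * z))       ≈⟨ distribˡ x (p * y) (- (w * z)) ⟩
      x * (p * y) + x * - (w * z)   ≈⟨ +-cong (x∙yz≈y∙xz x p y) (sym (-‿distribʳ-* x (w * z))) ⟩
      p * (x * y) + - (x * (w * z)) ≈⟨ +-congˡ (-‿cong (sym (*-assoc x w z))) ⟩
      p * (x * y) + - (x * w * z)   ∎

  eliminate-independent : ∀ {k n} (v : Fin (suc k) → Fin (suc n) → Carrier) a →
                          ¬ v a zero ≈ 0# → Independent (suc n) v → Independent n (eliminate v a)
  eliminate-independent v a p≉0 ind e rel b = *-cancelˡ-≈0 p≉0 (begin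
    p * e b            ≡⟨ insertAt-punchIn (λ b → p * e b) a (- S) b ⟨
    E (punchIn a b)    ≈⟨ ind E E-rel (punchIn a b) ⟩
    0#                 ∎)
    where
    p = v a zero
    S = combination e (removeAt v a) zero
    E = insertAt (λ b → p * e b) a (- S)
    E-split : ∀ i → combination E v i ≈ - S * v a i + p * combination e (removeAt v a) i
    E-split i = begin
      combination E v i
        ≈⟨ sum-remove {i = a} (λ x → E x * v x i) ⟩
      E a * v a i + sum (λ b → E (punchIn a b) * v (punchIn a b) i)
        ≡⟨ cong₂ _+_ (cong (_* v a i) (insertAt-lookup _ a (- S)))
                     (sum-cong-≗ (λ b → cong (_* v (punchIn a b) i) (insertAt-punchIn _ a (- S) b))) ⟩
      - S * v a i + combination (λ b → p * e b) (removeAt v a) i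
        ≈⟨ +-congˡ (combination-* p e (removeAt v a) i) ⟩
      - S * v a i + p * combination e (removeAt v a) i ∎
    E-rel : ∀ i → combination E v i ≈ 0#
    E-rel zero = begin
      combination E v zero   ≈⟨ E-split zero ⟩
      - S * p + p * S        ≈⟨ +-cong (sym (-‿distribˡ-* S p)) (*-comm p S) ⟩
      - (S * p) + S * p      ≈⟨ -‿inverseˡ (S * p) ⟩
      0#                     ∎
    E-rel (suc i) = begin
      combination E v (suc i)           ≈⟨ E-split (suc i) ⟩
      - S * z + p * X                   ≈⟨ +-comm _ _ ⟩
      p * X + - S * z                   ≈⟨ +-congˡ (sym (-‿distribˡ-* S z)) ⟩
      p * X + - (S * z)                 ≈⟨ combination-eliminate v a e i ⟨
      combination e (eliminate v a) i   ≈⟨ rel i ⟩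
      0#                                ∎
      where
      z = v a (suc i)
      X = combination e (removeAt v a) (suc i)

  independent-tail : ∀ {k n} (v : Fin k → Fin (suc n) → Carrier) → (∀ a → v a zero ≈ 0#) →
                     Independent (suc n) v → Independent n (λ a i → v a (suc i))
  independent-tail v v0≈0 ind g rel = ind g λ
    { zero    → sum-zero _ (λ a → trans (*-congˡ (v0≈0 a)) (zeroʳ (g a)))
    ; (suc i) → rel i }

  independent⇒length≤dim : ∀ {k} n (v : Fin k → Fin n → Carrier) → Independent n v → k ℕ.≤ n
  independent⇒length≤dim {zero}  n       v ind = z≤n
  independent⇒length≤dim {suc k} zero    v ind = ⊥-elim (1≉0 (ind (const 1#) (λ ()) zero))
  independent⇒length≤dim {suc k} (suc n) v ind with FinP.any? (λ a → ¬? (v a zero ≈? 0#))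
  ... | yes (a , p≉0) = s≤s (independent⇒length≤dim n (eliminate v a) (eliminate-independent v a p≉0 ind))
  ... | no  no-pivot  =
    ℕP.m≤n⇒m≤1+n (independent⇒length≤dim n (λ a i → v a (suc i)) (independent-tail v v0≈0 ind))
    where
    v0≈0 : ∀ a → v a zero ≈ 0#
    v0≈0 a = decidable-stable (v a zero ≈? 0#) (λ p≉0 → no-pivot (a , p≉0))

  -- Over a finite field there are finitely many coefficient vectors, so dependence is decidable.
  coefficientVectors : ∀ k → List (Fin k → Carrier)
  coefficientVectors zero    = List.[ (λ ()) ]
  coefficientVectors (suc k) = cartesianProductWith _∷_ elements (coefficientVectors k)

  coefficientVectors-complete : ∀ {k} (g : Fin k → Carrier) → Any (g ≋_) (coefficientVectors k)
  coefficientVectors-complete {zero}  g = here (λ ())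
  coefficientVectors-complete {suc k} g =
    cartesianProductWith⁺ _∷_ (λ g0≈x tail≋ → λ { zero → g0≈x ; (suc i) → tail≋ i })
                          (complete (g zero)) (coefficientVectors-complete (g ∘ suc))

  NontrivialRelation : ∀ {k n} → (Fin k → Fin n → Carrier) → (Fin k → Carrier) → Set ℓ
  NontrivialRelation v g = (∀ i → combination g v i ≈ 0#) × ∃ λ a → ¬ g a ≈ 0#

  nontrivialRelation-resp : ∀ {k n} (v : Fin k → Fin n → Carrier) {g h} →
                            g ≋ h → NontrivialRelation v g → NontrivialRelation v h
  nontrivialRelation-resp v g≋h (rel , a , ga≉0) =
    (λ i → trans (sum-cong-≋ (λ x → *-congʳ (sym (g≋h x)))) (rel i)) ,
    a , (λ ha≈0 → ga≉0 (trans (g≋h a) ha≈0))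

  isNontrivialRelation? : ∀ {k n} (v : Fin k → Fin n → Carrier) g → Dec (NontrivialRelation v g)
  isNontrivialRelation? v g =
    FinP.all? (λ i → combination g v i ≈? 0#) ×-dec FinP.any? (λ a → ¬? (g a ≈? 0#))

  nontrivialRelation? : ∀ {k n} (v : Fin k → Fin n → Carrier) → Dec (∃ (NontrivialRelation v))
  nontrivialRelation? {k} v with Any.any? (isNontrivialRelation? v) (coefficientVectors k)
  ... | yes found = yes (Any.satisfied found)
  ... | no  none  = no λ (g , rel) →
    none (Any.map (λ g≋h → nontrivialRelation-resp v g≋h rel) (coefficientVectors-complete g))

  ¬nontrivialRelation⇒independent : ∀ {k n} {v : Fin k → Fin n → Carrier} →
                                    ¬ ∃ (NontrivialRelation v) → Independent n v
  ¬nontrivialRelation⇒independent none g rel a =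
    decidable-stable (g a ≈? 0#) (λ ga≉0 → none (g , rel , a , ga≉0))

  independent? : ∀ {k n} (v : Fin k → Fin n → Carrier) → Dec (Independent n v)
  independent? v with nontrivialRelation? v
  ... | yes (g , rel , a , ga≉0) = no λ ind → ga≉0 (ind g rel a)
  ... | no  none                 = yes (¬nontrivialRelation⇒independent none)

  dependent⇒nontrivialRelation : ∀ {k n} (v : Fin k → Fin n → Carrier) →
                                 ¬ Independent n v → ∃ (NontrivialRelation v)
  dependent⇒nontrivialRelation v dep =
    decidable-stable (nontrivialRelation? v) (dep ∘ ¬nontrivialRelation⇒independent)

  nontrivialRelation-head≉0 : ∀ {k n} {N : Fin k → Fin n → Carrier} {u g} →
                              Independent n N → NontrivialRelation (u ∷ N) g → ¬ g zero ≈ 0#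
  nontrivialRelation-head≉0 {N = N} {u} {g} indN (rel , a , ga≉0) g0≈0 = ga≉0 (g≈0 a)
    where
    g≈0 : ∀ a → g a ≈ 0#
    g≈0 zero    = g0≈0
    g≈0 (suc x) = indN (g ∘ suc) (λ i → begin
      combination (g ∘ suc) N i                 ≈⟨ +-identityˡ _ ⟨
      0# + combination (g ∘ suc) N i            ≈⟨ +-congʳ (trans (*-congʳ g0≈0) (zeroˡ (u i))) ⟨
      g zero * u i + combination (g ∘ suc) N i  ≈⟨ rel i ⟩
      0#                                        ∎) x

  IndependentOfPrefix : ∀ {k n} → ℕ → (Fin k → Fin n → Carrier) → (Fin n → Carrier) → Set (c ⊔ ℓ)
  IndependentOfPrefix d v u =
    ∀ s g → (∀ x → d ℕ.≤ toℕ x → g x ≈ 0#) →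
    (∀ i → s * u i + combination g v i ≈ 0#) → s ≈ 0#

  independentOfPrefix : ∀ {k n} {M N : Fin k → Fin n → Carrier} → Independent n M → (d : Fin k) →
                        (∀ x → toℕ x ℕ.< toℕ d → ∀ i → M x i ≈ N x i) →
                        IndependentOfPrefix (toℕ d) N (M d)
  independentOfPrefix {M = M} {N} indM d M≈N s g g≈0 rel = begin
    s              ≈⟨ trans (+-identityˡ _) (*-identityʳ s) ⟨
    0# + s * 1#    ≈⟨ +-cong (g≈0 d ℕP.≤-refl) (*-congˡ (reflexive (updateAt-updates d _))) ⟨
    h d            ≈⟨ indM h h-rel d ⟩
    0#             ∎
    where
    h = λ x → g x + s * δ d x
    gM≈gN : ∀ i x → g x * M x i ≈ g x * N x i
    gM≈gN i x with toℕ x ℕP.<? toℕ d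
    ... | yes x<d = *-congˡ (M≈N x x<d i)
    ... | no  x≮d = trans (*-congʳ gx≈0) (trans (zeroˡ _) (sym (trans (*-congʳ gx≈0) (zeroˡ _))))
      where gx≈0 = g≈0 x (ℕP.≮⇒≥ x≮d)
    h-rel : ∀ i → combination h M i ≈ 0#
    h-rel i = begin
      combination h M i
        ≈⟨ combination-+ g _ M i ⟩
      combination g M i + combination (λ x → s * δ d x) M i
        ≈⟨ +-cong (sum-cong-≋ (gM≈gN i)) (combination-* s (δ d) M i) ⟩
      combination g N i + s * combination (δ d) M i
        ≈⟨ +-congˡ (*-congˡ (combination-δ d M i)) ⟩
      combination g N i + s * M d i
        ≈⟨ trans (+-comm _ _) (rel i) ⟩
      0# ∎

  -- e' is what e becomes after substituting u = -(∑ g N)/s, scaled by s; independence of N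
  -- gives e' ≈ 0, which forces e j ≈ 0 because g j ≉ 0 and then the other e x ≈ 0 because s ≉ 0.
  exchange-independent : ∀ {n} (N : Fin n → Fin n → Carrier) u s (g : Fin n → Carrier) j →
                         Independent n N → ¬ s ≈ 0# → ¬ g j ≈ 0# →
                         (∀ i → s * u i + combination g N i ≈ 0#) → Independent n (updateAt N j (const u))
  exchange-independent N u s g j indN s≉0 gj≉0 rel e e-rel = e≈0
    where
    E = updateAt e j (const 0#)
    e' = λ x → s * E x + - e j * g x
    e'-rel : ∀ i → combination e' N i ≈ 0#
    e'-rel i = begin
      combination e' N i
        ≈⟨ combination-+ (λ x → s * E x) _ N i ⟩
      combination (λ x → s * E x) N i + combination (λ x → - e j * g x) N i
        ≈⟨ +-cong (combination-* s E N i) (combination-* (- e j) g N i) ⟩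
      s * combination E N i + - e j * combination g N i
        ≈⟨ +-congˡ (*-congˡ (+-inverseʳ-unique _ _ (rel i))) ⟩
      s * combination E N i + - e j * - (s * u i)
        ≈⟨ +-congˡ (-x*-yz≈y*xz (e j) s (u i)) ⟩
      s * combination E N i + s * (e j * u i)
        ≈⟨ distribˡ s _ _ ⟨
      s * (combination E N i + e j * u i)
        ≈⟨ *-congˡ (trans (sym (combination-updateAt e N j u i)) (e-rel i)) ⟩
      s * 0#
        ≈⟨ zeroʳ s ⟩
      0# ∎
    e'≈0 = indN e' e'-rel
    ej≈0 : e j ≈ 0#
    ej≈0 = -x≈0⇒x≈0 (*-cancelˡ-≈0 gj≉0 (begin
      g j * - e j              ≈⟨ *-comm _ _ ⟩
      - e j * g j              ≈⟨ trans (+-congʳ (zeroʳ s)) (+-identityˡ _) ⟨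
      s * 0# + - e j * g j     ≡⟨ cong (λ y → s * y + - e j * g j) (updateAt-updates j e) ⟨
      e' j                     ≈⟨ e'≈0 j ⟩
      0#                       ∎))
    e≈0 : ∀ x → e x ≈ 0#
    e≈0 x with x Fin.≟ j
    ... | yes refl = ej≈0
    ... | no  x≢j  = *-cancelˡ-≈0 s≉0 (begin
      s * e x                  ≈⟨ +-identityʳ _ ⟨
      s * e x + 0#             ≈⟨ +-congˡ (trans (*-congʳ (trans (-‿cong ej≈0) -0#≈0#)) (zeroˡ (g x))) ⟨
      s * e x + - e j * g x    ≡⟨ cong (λ y → s * y + - e j * g x) (updateAt-minimal x j e x≢j) ⟨
      e' x                     ≈⟨ e'≈0 x ⟩
      0#                       ∎)

  exchange : ∀ {n} (N : Fin n → Fin n → Carrier) u d → Independent n N → IndependentOfPrefix d N u →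
             ∃ λ j → d ℕ.≤ toℕ j × Independent n (updateAt N j (const u))
  exchange {n} N u d indN u-indep
    with dependent⇒nontrivialRelation (u ∷ N)
           (λ ind → ℕP.n≮n n (independent⇒length≤dim n (u ∷ N) ind))
  ... | g , nontrivial@(rel , _) with FinP.any? (λ j → (d ℕP.≤? toℕ j) ×-dec ¬? (g (suc j) ≈? 0#))
  ...   | yes (j , d≤j , gj≉0) =
    j , d≤j , exchange-independent N u (g zero) (g ∘ suc) j indN s≉0 gj≉0 rel
    where s≉0 = nontrivialRelation-head≉0 indN nontrivial
  ...   | no  none =
    ⊥-elim (nontrivialRelation-head≉0 indN nontrivial (u-indep (g zero) (g ∘ suc) prefix-only rel))
    where
    prefix-only : ∀ x → d ℕ.≤ toℕ x → g (suc x) ≈ 0#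
    prefix-only x d≤x = decidable-stable (g (suc x) ≈? 0#) (λ gx≉0 → none (x , d≤x , gx≉0))

transpose-≤ : ∀ {k} {i j q : Fin k} x → (i ≤ q → j ≤ q) → (j ≤ q → i ≤ q) → x ≤ q →
              PC.transpose i j x ≤ q
transpose-≤ {i = i} {j} x i≤q⇒j≤q j≤q⇒i≤q x≤q with x Fin.≟ i
... | yes refl = i≤q⇒j≤q x≤q
... | no  _ with x Fin.≟ j
...   | yes refl = j≤q⇒i≤q x≤q
...   | no  _    = x≤q

transpose-fixes : ∀ {k} {i j : Fin k} x → x ≢ i → x ≢ j → PC.transpose i j x ≡ x
transpose-fixes {i = i} {j} x x≢i x≢j with x Fin.≟ i
... | yes x≡i = ⊥-elim (x≢i x≡i)
... | no  _ with x Fin.≟ j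
...   | yes x≡j = ⊥-elim (x≢j x≡j)
...   | no  _   = refl

transpose-matchˡ : ∀ {k} (i j : Fin k) → PC.transpose i j i ≡ j
transpose-matchˡ i j with i Fin.≟ i
... | yes _   = refl
... | no  i≢i = ⊥-elim (i≢i refl)

≤-last : ∀ {k} {b : Fin k} → suc (toℕ b) ≡ k → ∀ (p : Fin k) → p ≤ b
≤-last b-last p = ℕP.≤-pred (subst (toℕ p ℕ.<_) (≡.sym b-last) (FinP.toℕ<n p))

last-position : ∀ {k} (b : Fin k) → (∀ (p : Fin k) → p ≤ b) → suc (toℕ b) ≡ k
last-position {suc k} b all≤b =
  ℕP.≤-antisym (FinP.toℕ<n b) (s≤s (subst (ℕ._≤ toℕ b) (FinP.toℕ-fromℕ k) (all≤b (Fin.fromℕ k))))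

module _ {k m} (f : Fin k → Fin m) (a c : Fin k)
         (ascent : ∀ p q → toℕ q ≡ suc (toℕ p) → a ≤ p → q ≤ c → f p < f q) where

  increasing-between : ∀ p q → a ≤ p → p < q → q ≤ c → f p < f q
  increasing-between p q a≤p p<q = go (toℕ q) q refl p<q
    where
    go : ∀ t q → toℕ q ≡ t → p < q → q ≤ c → f p < f q
    go zero    q q≡0   p<q _   = ⊥-elim (ℕP.n≮0 (subst (toℕ p ℕ.<_) q≡0 p<q))
    go (suc t) q q≡t+1 p<q q≤c with toℕ p ℕP.≟ t
    ... | yes p≡t = ascent p q (≡.trans q≡t+1 (cong suc (≡.sym p≡t))) a≤p q≤c
    ... | no  p≢t =
      ℕP.<-trans (go t r r≡t p<r r≤c) (ascent r q (≡.trans q≡t+1 (cong suc (≡.sym r≡t))) a≤r q≤c)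
      where
      t<k : t ℕ.< k
      t<k = ℕP.<-trans (ℕP.n<1+n t) (subst (ℕ._< k) q≡t+1 (FinP.toℕ<n q))
      r = Fin.fromℕ< t<k
      r≡t = FinP.toℕ-fromℕ< t<k
      p<r : p < r
      p<r = subst (toℕ p ℕ.<_) (≡.sym r≡t)
                  (ℕP.≤∧≢⇒< (ℕP.≤-pred (subst (toℕ p ℕ.<_) q≡t+1 p<q)) p≢t)
      r≤c : r ≤ c
      r≤c = ℕP.≤-trans (ℕP.≤-trans (ℕP.≤-reflexive r≡t) (ℕP.n≤1+n t))
                       (subst (ℕ._≤ toℕ c) q≡t+1 q≤c)
      a≤r : a ≤ r
      a≤r = ℕP.≤-trans a≤p (ℕP.<⇒≤ p<r)

module Chains {c ℓ : Level} (F : FiniteField c ℓ) (n : ℕ) (L : LineOrdering F n) where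
  open FiniteField F using (reflexive)
  open ≡ using (sym; trans)
  open LineOrdering L
  open PD F n L
  open LinearAlgebra F
    using (independent?; independent-cong; independent-injective; independent-permute; independentOfPrefix; exchange)

  label-injective : ∀ N {p q} → label N p ≡ label N q → p ≡ q
  label-injective N eq = independent-injective (basis N) (λ i → reflexive (cong (λ l → rep l i) eq))

  replace-updates : ∀ f p l → replace f p l p ≡ l
  replace-updates f p l with p Fin.≟ p
  ... | yes _   = refl
  ... | no  p≢p = ⊥-elim (p≢p refl)

  replace-minimal : ∀ f p l q → q ≢ p → replace f p l q ≡ f q
  replace-minimal f p l q q≢p with q Fin.≟ p
  ... | yes q≡p = ⊥-elim (q≢p q≡p)
  ... | no  _   = refl

  rep∘replace : ∀ f p l q → rep (replace f p l q) ≡ updateAt (rep ∘ f) p (const (rep l)) q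
  rep∘replace f p l q with q Fin.≟ p
  ... | yes refl = sym (updateAt-updates q (rep ∘ f))
  ... | no  q≢p  = sym (updateAt-minimal q p (rep ∘ f) q≢p)

  InternallyPassive : SaturatedChain → Fin n → Set (c ⊔ ℓ)
  InternallyPassive N p = ∃ λ l' → l' < label N p × IsBasis (replace (label N) p l')

  internallyPassive? : ∀ N p → Dec (InternallyPassive N p)
  internallyPassive? N p =
    FinP.any? (λ l' → (l' FinP.<? label N p) ×-dec independent? (rep ∘ replace (label N) p l'))

  descent? : ∀ N a → Dec (Descent N a)
  descent? N a = FinP.any? (λ b → (toℕ b ℕP.≟ suc (toℕ a)) ×-dec (label N b FinP.<? label N a))

  LexFirstDifference : SaturatedChain → SaturatedChain → Fin n → Set
  LexFirstDifference M N d = (∀ x → x < d → label M x ≡ label N x) × label M d < label N d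

  NoEarlierExtension : SaturatedChain → Face → Set (lsuc 0ℓ ⊔ c ⊔ ℓ)
  NoEarlierExtension N S = ∀ (S' : Face) → S ⊆ S' → (∃ λ p → p ∈ S' × p ∉ S) → ¬ InEarlier N S'

  firstDifference-labelLater : ∀ M N {d k} → LexFirstDifference M N d → label N k ≡ label M d → d < k
  firstDifference-labelLater M N {d} {k} (agree , Md<Nd) Nk≡Md with FinP.<-cmp k d
  ... | tri< k<d _ _  = ⊥-elim (FinP.<⇒≢ k<d (label-injective M (trans (agree k k<d) Nk≡Md)))
  ... | tri≈ _ refl _ = ⊥-elim (FinP.<-irrefl (sym Nk≡Md) Md<Nd)
  ... | tri> _ _ d<k  = d<k

  sameElement⇒labelBelow : ∀ M N {p} d → SameElementAt M N p → d ≤ p →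
                           ∃ λ k → k ≤ p × label N k ≡ label M d
  sameElement⇒labelBelow M N d same d≤p = Equivalence.to (same (label M d)) (d , d≤p , refl)

  firstDifference-¬same : ∀ M N {d} → LexFirstDifference M N d → ¬ SameElementAt M N d
  firstDifference-¬same M N {d} fd same with sameElement⇒labelBelow M N d same ℕP.≤-refl
  ... | k , k≤d , Nk≡Md = ℕP.<⇒≱ (firstDifference-labelLater M N fd Nk≡Md) k≤d

  labelLater⇒¬same : ∀ M N {d k p} → label N k ≡ label M d → d ≤ p → p < k → ¬ SameElementAt M N p
  labelLater⇒¬same M N {d} Nk≡Md d≤p p<k same with sameElement⇒labelBelow M N d same d≤p
  ... | k' , k'≤p , Nk'≡Md =
    ℕP.<⇒≱ p<k (subst (_≤ _) (label-injective N (trans Nk'≡Md (sym Nk≡Md))) k'≤p)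

  labelMissing⇒¬same : ∀ M N {d p} → (∀ k → label N k ≢ label M d) → d ≤ p → ¬ SameElementAt M N p
  labelMissing⇒¬same M N {d} missing d≤p same with sameElement⇒labelBelow M N d same d≤p
  ... | k , _ , Nk≡Md = missing k Nk≡Md

  inEarlier-antitone : ∀ N {S S' : Face} → S' ⊆ S → InEarlier N S → InEarlier N S'
  inEarlier-antitone N S'⊆S (M , M<N , same) = M , M<N , λ p p∈S' → same p (S'⊆S p∈S')

  descent⇒inEarlier : ∀ N p → Descent N p → InEarlier N (_≢ p)
  descent⇒inEarlier N p (q , q≡p+1 , Nq<Np) = M , (p , agree , Mp<Np) , same
    where
    M : SaturatedChain
    M = record { label = label N ∘ PC.transpose p q
               ; basis = independent-permute (Perm.transpose p q) (basis N) }
    p<q : p < q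
    p<q = ℕP.≤-reflexive (sym q≡p+1)
    agree : ∀ x → x < p → label M x ≡ label N x
    agree x x<p = cong (label N) (transpose-fixes x (FinP.<⇒≢ x<p) (FinP.<⇒≢ (ℕP.<-trans x<p p<q)))
    Mp<Np : label M p < label N p
    Mp<Np = subst (λ x → label N x < label N p) (sym (transpose-matchˡ p q)) Nq<Np
    same : ∀ r → r ≢ p → SameElementAt M N r
    same r r≢p t = mk⇔
      (λ (x , x≤r , eq) → PC.transpose p q x , transpose-≤ x p≤r⇒q≤r q≤r⇒p≤r x≤r , eq)
      (λ (y , y≤r , eq) → PC.transpose q p y , transpose-≤ y q≤r⇒p≤r p≤r⇒q≤r y≤r ,
                           trans (cong (label N) (PC.transpose-inverse p q)) eq)
      where
      p≤r⇒q≤r : p ≤ r → q ≤ r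
      p≤r⇒q≤r p≤r =
        subst (ℕ._≤ toℕ r) (sym q≡p+1)
              (ℕP.≤∧≢⇒< p≤r (λ p≡r → r≢p (sym (FinP.toℕ-injective p≡r))))
      q≤r⇒p≤r : q ≤ r → p ≤ r
      q≤r⇒p≤r q≤r = ℕP.<⇒≤ (ℕP.<-≤-trans p<q q≤r)

  passive⇒inEarlier : ∀ N p → InternallyPassive N p → InEarlier N (_< p)
  passive⇒inEarlier N p (l' , l'<Np , isBasis) = M , (p , agree , Mp<Np) , same
    where
    M : SaturatedChain
    M = record { label = replace (label N) p l' ; basis = isBasis }
    agree : ∀ x → x < p → label M x ≡ label N x
    agree x x<p = replace-minimal (label N) p l' x (FinP.<⇒≢ x<p)
    Mp<Np : label M p < label N p
    Mp<Np = subst (_< label N p) (sym (replace-updates (label N) p l')) l'<Np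
    same : ∀ r → r < p → SameElementAt M N r
    same r r<p t = mk⇔
      (λ (x , x≤r , eq) → x , x≤r , trans (sym (agree x (ℕP.≤-<-trans x≤r r<p))) eq)
      (λ (x , x≤r , eq) → x , x≤r , trans (agree x (ℕP.≤-<-trans x≤r r<p)) eq)

  noDescent⇒increasing : ∀ N a c → (∀ p → a ≤ p → p < c → ¬ Descent N p) →
                         ∀ p q → a ≤ p → p < q → q ≤ c → label N p < label N q
  noDescent⇒increasing N a c no-descent = increasing-between (label N) a c ascent
    where
    ascent : ∀ p q → toℕ q ≡ suc (toℕ p) → a ≤ p → q ≤ c → label N p < label N q
    ascent p q q≡p+1 a≤p q≤c with FinP.<-cmp (label N p) (label N q)
    ... | tri< Np<Nq _ _ = Np<Nq
    ... | tri≈ _ Np≡Nq _ =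
      ⊥-elim (ℕP.1+n≢n (trans (sym q≡p+1) (cong toℕ (sym (label-injective N Np≡Nq)))))
    ... | tri> _ _ Nq<Np =
      ⊥-elim (no-descent p a≤p (ℕP.≤-trans (ℕP.≤-reflexive (sym q≡p+1)) q≤c) (q , q≡p+1 , Nq<Np))

  descent-between : ∀ N {d k} → d < k → label N k < label N d → ∃ λ p → d ≤ p × p < k × Descent N p
  descent-between N {d} {k} d<k Nk<Nd
    with FinP.any? (λ p → (d FinP.≤? p) ×-dec (p FinP.<? k) ×-dec descent? N p)
  ... | yes found = found
  ... | no  none  = ⊥-elim (ℕP.<-asym Nk<Nd (increasing d k ℕP.≤-refl d<k ℕP.≤-refl))
    where increasing = noDescent⇒increasing N d k (λ p d≤p p<k desc → none (p , d≤p , p<k , desc))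

  firstDifference-exchange : ∀ M N {d} → LexFirstDifference M N d →
                             ∃ λ j → d ≤ j × IsBasis (replace (label N) j (label M d))
  firstDifference-exchange M N {d} (agree , _)
    with exchange (rep ∘ label N) (rep (label M d)) (toℕ d) (basis N)
                  (independentOfPrefix (basis M) d (λ x x<d i → reflexive (cong (λ l → rep l i) (agree x x<d))))
  ... | j , d≤j , independent =
    j , d≤j , independent-cong (λ q i → reflexive (cong (_$ i) (sym (rep∘replace (label N) j (label M d) q))))
                               independent

  firstDifference⇒passive : ∀ M N {d a : Fin n} → LexFirstDifference M N d → a ≤ d →
                            (∀ p q → a ≤ p → p < q → label N p < label N q) →
                            ∃ λ j → d ≤ j × InternallyPassive N j
  firstDifference⇒passive M N {d} fd a≤d increasing with firstDifference-exchange M N fd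
  ... | j , d≤j , isBasis = j , d≤j , label M d , Md<Nj , isBasis
    where
    Md<Nj : label M d < label N j
    Md<Nj with ℕP.m≤n⇒m<n∨m≡n d≤j
    ... | inj₁ d<j = ℕP.<-trans (proj₂ fd) (increasing d j a≤d d<j)
    ... | inj₂ d≡j = subst (λ x → label M d < label N x) (FinP.toℕ-injective d≡j) (proj₂ fd)

  inside : ∀ {a b p} → ¬ OutsideInterval a b p → a ≤ p × p ≤ b
  inside {a} {b} {p} = decidable-stable ((a FinP.≤? p) ×-dec (p FinP.≤? b))

  changed⇒inside : ∀ M N {a b p} → (∀ q → OutsideInterval a b q → SameElementAt M N q) →
                   ¬ SameElementAt M N p → a ≤ p × p ≤ b
  changed⇒inside M N same-outside changed = inside (λ out → changed (same-outside _ out))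

  maximal-descent⇒singleton : ∀ N {a b p} → a ≤ b → NoEarlierExtension N (OutsideInterval a b) →
                              Descent N p → a ≤ p → p ≤ b → a ≡ b × Descent N a
  maximal-descent⇒singleton N {a} {b} {p} a≤b maximal desc a≤p p≤b =
    trans a≡p (sym b≡p) , subst (Descent N) (sym a≡p) desc
    where
    only-p : ∀ x → a ≤ x → x ≤ b → x ≡ p
    only-p x a≤x x≤b = decidable-stable (x Fin.≟ p) λ x≢p →
      maximal (_≢ p) (λ out → λ { refl → out (a≤p , p≤b) }) (x , x≢p , λ out → out (a≤x , x≤b))
              (descent⇒inEarlier N p desc)
    a≡p = only-p a ℕP.≤-refl a≤b
    b≡p = only-p b a≤b ℕP.≤-refl

  maximal-last⇒active : ∀ N {a b p} → a ≤ b → NoEarlierExtension N (OutsideInterval a b) →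
                        suc (toℕ b) ≡ n → a < p → InternallyActive N p
  maximal-last⇒active N {a} {b} {p} a≤b maximal b-last a<p passive =
    maximal (_< p) outside⊆below (a , a<p , λ out → out (ℕP.≤-refl , a≤b)) (passive⇒inEarlier N p passive)
    where
    outside⊆below : OutsideInterval a b ⊆ (_< p)
    outside⊆below {x} out = ℕP.≰⇒> λ p≤x → out (ℕP.≤-trans (ℕP.<⇒≤ a<p) p≤x , ≤-last b-last x)

  missingLabel⇒descent⊎top : ∀ M N {a b d} → a ≤ b → NoEarlierExtension N (OutsideInterval a b) →
    LexFirstDifference M N d → (∀ q → OutsideInterval a b q → SameElementAt M N q) →
    (∀ k → label N k ≢ label M d) → (a ≡ b × Descent N a) ⊎ TopInterval N a b
  missingLabel⇒descent⊎top M N {a} {b} {d} a≤b maximal fd same-outside missing = result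
    where
    d-inside = changed⇒inside M N same-outside (firstDifference-¬same M N fd)
    all≤b : ∀ p → p ≤ b
    all≤b p with d FinP.≤? p
    ... | yes d≤p = proj₂ (changed⇒inside M N same-outside (labelMissing⇒¬same M N missing d≤p))
    ... | no  d≰p = ℕP.≤-trans (ℕP.<⇒≤ (ℕP.≰⇒> d≰p)) (proj₂ d-inside)
    b-last = last-position b all≤b
    result : (a ≡ b × Descent N a) ⊎ TopInterval N a b
    result with FinP.any? (λ p → (a FinP.≤? p) ×-dec descent? N p)
    ... | yes (p , a≤p , desc) = inj₁ (maximal-descent⇒singleton N a≤b maximal desc a≤p (all≤b p))
    ... | no  no-descent       =
      inj₂ (b-last , increasing , passive-a , λ p a<p → maximal-last⇒active N a≤b maximal b-last a<p)
      where
      increasing : ∀ p q → a ≤ p → p < q → label N p < label N q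
      increasing p q a≤p p<q =
        noDescent⇒increasing N a b (λ p a≤p _ desc → no-descent (p , a≤p , desc)) p q a≤p p<q (all≤b q)
      passive-a : ¬ InternallyActive N a
      passive-a active with firstDifference⇒passive M N fd (proj₁ d-inside) increasing
      ... | j , d≤j , passive with ℕP.m≤n⇒m<n∨m≡n (ℕP.≤-trans (proj₁ d-inside) d≤j)
      ...   | inj₁ a<j = maximal-last⇒active N a≤b maximal b-last a<j passive
      ...   | inj₂ a≡j = active (subst (InternallyPassive N) (sym (FinP.toℕ-injective a≡j)) passive)

  minimalSkipped⇒descent⊎top : ∀ N {a b} → a ≤ b → MinimalSkippedInterval N a b →
                               (a ≡ b × Descent N a) ⊎ TopInterval N a b
  minimalSkipped⇒descent⊎top N {a} {b} a≤b (_ , (M , (d , fd) , same-outside) , maximal)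
    with FinP.any? (λ k → label N k Fin.≟ label M d)
  ... | no  missing =
    missingLabel⇒descent⊎top M N a≤b maximal fd same-outside (λ k → missing ∘ (k ,_))
  ... | yes (k , Nk≡Md)
    with descent-between N (firstDifference-labelLater M N fd Nk≡Md) (subst (_< label N d) (sym Nk≡Md) (proj₂ fd))
  ...   | p , d≤p , p<k , desc = inj₁ (maximal-descent⇒singleton N a≤b maximal desc a≤p p≤b)
    where
    a≤p = ℕP.≤-trans (proj₁ (changed⇒inside M N same-outside (firstDifference-¬same M N fd))) d≤p
    p≤b = proj₂ (changed⇒inside M N same-outside (labelLater⇒¬same M N Nk≡Md d≤p p<k))

  descent⇒minimalSkipped : ∀ N {a} → Descent N a → MinimalSkippedInterval N a a
  descent⇒minimalSkipped N {a} desc = ℕP.≤-refl , earlier , maximal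
    where
    earlier : InEarlier N (OutsideInterval a a)
    earlier = inEarlier-antitone N (λ out → λ { refl → out (ℕP.≤-refl , ℕP.≤-refl) })
                                 (descent⇒inEarlier N a desc)
    maximal : NoEarlierExtension N (OutsideInterval a a)
    maximal S' outside⊆S' (p , p∈S' , p-inside) (M , (d , fd) , same) =
      firstDifference-¬same M N fd (same d d∈S')
      where
      d∈S' : d ∈ S'
      d∈S' with d Fin.≟ a
      ... | yes refl = subst S' (FinP.≤-antisym (proj₂ (inside p-inside)) (proj₁ (inside p-inside))) p∈S'
      ... | no  d≢a  = outside⊆S' (λ (a≤d , d≤a) → d≢a (FinP.≤-antisym d≤a a≤d))

  top⇒minimalSkipped : ∀ N {a b} → a ≤ b → TopInterval N a b → MinimalSkippedInterval N a b
  top⇒minimalSkipped N {a} {b} a≤b (b-last , increasing , ¬active-a , active) = a≤b , earlier , maximal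
    where
    earlier : InEarlier N (OutsideInterval a b)
    earlier with internallyPassive? N a
    ... | yes passive  = inEarlier-antitone N (λ {x} out → ℕP.≰⇒> λ a≤x → out (a≤x , ≤-last b-last x))
                                            (passive⇒inEarlier N a passive)
    ... | no  ¬passive = ⊥-elim (¬active-a ¬passive)
    maximal : NoEarlierExtension N (OutsideInterval a b)
    maximal S' outside⊆S' (p , p∈S' , p-inside) (M , (d , fd) , same) = contradiction
      where
      a≤d : a ≤ d
      a≤d = decidable-stable (a FinP.≤? d) λ a≰d →
        firstDifference-¬same M N fd (same d (outside⊆S' (λ (a≤d , _) → a≰d a≤d)))
      contradiction : ⊥
      contradiction with FinP.any? (λ k → label N k Fin.≟ label M d)
      ... | yes (k , Nk≡Md) = ℕP.<-asym (proj₂ fd)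
        (subst (label N d <_) Nk≡Md (increasing d k a≤d (firstDifference-labelLater M N fd Nk≡Md)))
      ... | no  missing with ℕP.m≤n⇒m<n∨m≡n a≤d
      ...   | inj₂ a≡d = labelMissing⇒¬same M N (λ k → missing ∘ (k ,_))
                           (subst (ℕ._≤ toℕ p) a≡d (proj₁ (inside p-inside))) (same p p∈S')
      ...   | inj₁ a<d with firstDifference⇒passive M N fd a≤d increasing
      ...     | j , d≤j , passive = active j (ℕP.<-≤-trans a<d d≤j) passive

proposition7p5 : ∀ {c ℓ : Level} (F : FiniteField c ℓ) (n : ℕ) (L : LineOrdering F n) →
    let open PD F n L in
    (N : SaturatedChain) (a b : Fin n) → a ≤ b →
    MinimalSkippedInterval N a b ⇔ ((a ≡ b × Descent N a) ⊎ TopInterval N a b)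
proposition7p5 F n L N a b a≤b =
  mk⇔ (minimalSkipped⇒descent⊎top N a≤b)
      [ (λ { (refl , desc) → descent⇒minimalSkipped N desc }) , top⇒minimalSkipped N a≤b ]
  where open Chains F n L
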